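{- Let $X$ be a finite set with at least two elements, and let $\succsim$ and $\trianglerighteq$ be distinct acyclic orders on $X$ with the same symmetric parts. Then $\succsim$ can be transformed into $\trianglerighteq$ by finitely many one-step perturbations; that is, there exist a positive integer $n$ and acyclic orders $\succsim_0,\dots,\succsim_{n-1}$ on $X$ such that $\succsim\,\rightarrow\,\succsim_0\,\twoheadrightarrow\,\trianglerighteq$, $\succsim_{k-1}\,\rightarrow\,\succsim_k\,\twoheadrightarrow\,\trianglerighteq$ for each $k=1,\dots,n-1$, and $\succsim_{n-1}=\trianglerighteq$.
   Context: A binary relation on $X$ is a nonempty subset $R\subseteq X\times X$; write $x\,R\,y$ for $(x,y)\in R$. The asymmetric part $R^>$ of $R$ is defined by $x\,R^>\,y$ iff $x\,R\,y$ and not $y\,R\,x$; the symmetric part of $R$ is $R\setminus R^>$. $\mathrm{Inc}(R)$ is the set of all $(x,y)\in X\times X$ such that neither $x\,R\,y$ nor $y\,R\,x$. $R$ is acyclic if there are no pairwise distinct $z_1,\dots,z_k\in X$ with $z_1\,R^>\,z_2\,R^>\cdots R^>\,z_k\,R^>\,z_1$. An acyclic order on $X$ is a reflexive acyclic binary relation on $X$. For an acyclic order $\succsim$ (resp. $\trianglerighteq$), $\succ$ (resp. $\vartriangleright$) denotes its asymmetric part and $\sim$ its symmetric part. Perturbations: let $\succsim$ be an acyclic order and $a\neq b$ in $X$. If neither $a\succ b$ nor $b\succ a$, put $R:=\succsim\cup\{(a,b)\}$ if $(a,b)\in\mathrm{Inc}(\succsim)$, and $R:=\succsim\setminus\{(b,a)\}$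 if $a\sim b$; if this $R$ is acyclic, define $\succsim\oplus(a,b):=R$ (otherwise $\succsim\oplus(a,b)$ is undefined). If $a\succ b$, define $\succsim\ominus(a,b):=\succsim\setminus\{(a,b)\}$. For acyclic orders $\succsim,\succsim_0,\trianglerighteq$, we say $\succsim_0$ is a one-step perturbation of $\succsim$ toward $\trianglerighteq$, written $\succsim\,\rightarrow\,\succsim_0\,\twoheadrightarrow\,\trianglerighteq$, if either (i) there are $a,b$ with $a\succ b$, $\succsim_0=\succsim\ominus(a,b)$, not $a\vartriangleright b$, and $x\succ b$ for every $x\in X$ with $x\vartriangleright b$; or (ii) there are distinct $a,b$ with $(a,b)\in\mathrm{Inc}(\succ)$ such that $\succsim\oplus(a,b)$ is defined, $\succsim_0=\succsim\oplus(a,b)$, and $a\vartriangleright b$. -}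

module Defs where

open import Data.Nat using (ℕ; suc)
open import Data.Fin using (Fin; zero; suc; inject₁; fromℕ; _≟_)
open import Data.Bool using (Bool; true; false; _∧_; _∨_; not)
open import Data.Product using (_×_; ∃; ∃-syntax)
open import Data.Sum using (_⊎_)
open import Relation.Nullary using (¬_)
open import Relation.Nullary.Decidable using (⌊_⌋)
open import Relation.Binary.PropositionalEquality using (_≡_; _≢_)
open import Function.Definitions using (Injective)

-- A binary relation on the finite set X = Fin n, given by its (decidable)
-- characteristic function: x R y  iff  R x y ≡ true.
BRel : ℕ → Set
BRel n = Fin n → Fin n → Bool

module _ {n : ℕ} where

  _∋_⟨_⟩ : BRel n → Fin n → Fin n → Set
  R ∋ x ⟨ y ⟩ = R x y ≡ true

  asym : BRel n → BRel n
  asym R x y = R x y ∧ not (R y x)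

  symm : BRel n → BRel n
  symm R x y = R x y ∧ R y x

  Inc : BRel n → Fin n → Fin n → Set
  Inc R x y = ¬ (R ∋ x ⟨ y ⟩) × ¬ (R ∋ y ⟨ x ⟩)

  _≐_ : BRel n → BRel n → Set
  R ≐ S = ∀ x y → R x y ≡ S x y

  addPair : BRel n → Fin n → Fin n → BRel n
  addPair R a b x y = R x y ∨ (⌊ x ≟ a ⌋ ∧ ⌊ y ≟ b ⌋)

  removePair : BRel n → Fin n → Fin n → BRel n
  removePair R a b x y = R x y ∧ not (⌊ x ≟ a ⌋ ∧ ⌊ y ≟ b ⌋)

  Acyclic : BRel n → Set
  Acyclic R = ∀ (k : ℕ) (z : Fin (suc k) → Fin n) → Injective _≡_ _≡_ z →
    ¬ ( (∀ (i : Fin k) → asym R ∋ z (inject₁ i) ⟨ z (suc i) ⟩)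
      × asym R ∋ z (fromℕ k) ⟨ z zero ⟩ )

  Reflexive : BRel n → Set
  Reflexive R = ∀ x → R ∋ x ⟨ x ⟩

  AcyclicOrder : BRel n → Set
  AcyclicOrder R = Reflexive R × Acyclic R

  -- R₀ ≐ R ⊕ (a , b)  (in particular R ⊕ (a , b) is defined)
  IsOplus : BRel n → Fin n → Fin n → BRel n → Set
  IsOplus R a b R₀ =
    a ≢ b × ¬ (asym R ∋ a ⟨ b ⟩) × ¬ (asym R ∋ b ⟨ a ⟩) ×
    ( (Inc R a b × R₀ ≐ addPair R a b)
    ⊎ (symm R ∋ a ⟨ b ⟩ × R₀ ≐ removePair R b a) ) ×
    Acyclic R₀

  -- R → R₀ ↠ T  (one-step perturbation of R toward T)
  OneStep : BRel n → BRel n → BRel n → Set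
  OneStep R R₀ T =
    ( ∃[ a ] ∃[ b ] ( asym R ∋ a ⟨ b ⟩ × R₀ ≐ removePair R a b
                    × ¬ (asym T ∋ a ⟨ b ⟩)
                    × (∀ x → asym T ∋ x ⟨ b ⟩ → asym R ∋ x ⟨ b ⟩) ) )
    ⊎
    ( ∃[ a ] ∃[ b ] ( a ≢ b × ¬ (asym R ∋ a ⟨ b ⟩) × ¬ (asym R ∋ b ⟨ a ⟩)
                    × IsOplus R a b R₀ × asym T ∋ a ⟨ b ⟩ ) )

-- Let h be a height on X that strictly decreases along ▷ (h x is the length of a
-- longest ▷-walk from x, finite because ▷ is acyclic and X finite). While ≿ ≠ ⊵,
-- one pair can be made to agree with ⊵ by a single perturbation. If some a ≻ b
-- has not a ▷ b, take one with h b maximal: if every x ▷ b has x ≻ b, remove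
-- (a , b); otherwise some x ▷ b is, by the maximality of h b, ≿-incomparable to b,
-- and (x , b) is added. If there is no such pair, ≻ ⊆ ▷, and a pair on which ≿ and
-- ⊵ differ is a ≿-incomparable ▷-pair, which is added. Adding (x , b) creates no
-- cycle: the points of height at most h b contain b but not x and are closed under
-- the new strict part. Each step lowers the number of pairs on which ≿ and ⊵ differ.
module Submission where

open import Defs
open import Algebra.Properties.Monoid.Sum using (sum)
open import Data.Bool using (Bool; true; false; _∧_; _∨_; not; if_then_else_)
import Data.Bool as Bool
open import Data.Bool.Properties using (∧-zeroʳ; ∧-identityʳ; ∨-zeroʳ; ∨-identityʳ; ¬-not)
open import Data.Empty using (⊥; ⊥-elim)
open import Data.Fin using (Fin; zero; suc; inject₁; fromℕ; toℕ; _≟_)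
open import Data.Fin.Properties
  using (any?; all?; ¬∀⟶∃¬; pigeonhole; toℕ<n; toℕ-inject₁; toℕ-fromℕ; <-cmp; _<?_)
open import Data.Nat using (ℕ; zero; suc; _≤_; _<_; _+_; _⊔_; z≤n; s≤s; s≤s⁻¹; _≤?_)
open import Data.Nat.Induction using (<-wellFounded)
open import Data.Nat.Properties
  using (≤-refl; ≤-trans; ≤-reflexive; <⇒≤; <-≤-trans; ≤-<-trans; <⇒≱; ≰⇒>; n≤1+n; n<1+n;
         m≤n+m; +-suc; +-identityʳ; +-monoʳ-<; ⊔-sel; m≤m⊔n; m≤n⊔m; suc-injective; m≤n⇒∃[o]m+o≡n;
         +-mono-≤; +-mono-<-≤; +-mono-≤-<; +-0-monoid)
open import Data.Product using (_×_; _,_; proj₁; proj₂; ∃; ∃₂; ∃-syntax; Σ-syntax)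
open import Data.Sum using (_⊎_; inj₁; inj₂)
open import Data.Vec.Functional using (_∷_)
open import Function using (_∘_; const)
open import Induction.WellFounded using (Acc; acc)
open import Relation.Binary using (tri<; tri≈; tri>)
open import Relation.Binary.PropositionalEquality
open import Relation.Nullary using (¬_; Dec; yes; no; does; contradiction)
open import Relation.Nullary.Decidable using (_×-dec_; _→-dec_; ¬?; dec-true; decidable-stable)
open import Relation.Unary using (Decidable)

private
  variable
    n : ℕ
    R S T : BRel n
    a b u v x y : Fin n

∑ : ∀ {m} → (Fin m → ℕ) → ℕ
∑ = sum +-0-monoid

∑-mono-≤ : ∀ {m} {f g : Fin m → ℕ} → (∀ i → f i ≤ g i) → ∑ f ≤ ∑ g
∑-mono-≤ {zero} f≤g = z≤n
∑-mono-≤ {suc m} f≤g = +-mono-≤ (f≤g zero) (∑-mono-≤ (f≤g ∘ suc))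

∑-mono-< : ∀ {m} {f g : Fin m → ℕ} → (∀ i → f i ≤ g i) → ∀ j → f j < g j → ∑ f < ∑ g
∑-mono-< f≤g zero fj<gj = +-mono-<-≤ fj<gj (∑-mono-≤ (f≤g ∘ suc))
∑-mono-< f≤g (suc j) fj<gj = +-mono-≤-< (f≤g zero) (∑-mono-< (f≤g ∘ suc) j fj<gj)

maximum : ∀ {m} → (Fin m → ℕ) → ℕ
maximum {zero} f = 0
maximum {suc m} f = f zero ⊔ maximum (f ∘ suc)

≤-maximum : ∀ {m} (f : Fin m → ℕ) i → f i ≤ maximum f
≤-maximum f zero = m≤m⊔n _ _
≤-maximum f (suc i) = ≤-trans (≤-maximum (f ∘ suc) i) (m≤n⊔m _ _)

maximum-attained : ∀ {m} (f : Fin m → ℕ) {k} → maximum f ≡ suc k → ∃ λ i → f i ≡ suc k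
maximum-attained {suc m} f max≡ with ⊔-sel (f zero) (maximum (f ∘ suc))
... | inj₁ e = zero , trans (sym e) max≡
... | inj₂ e with maximum-attained (f ∘ suc) (trans (sym e) max≡)
...   | i , fi≡ = suc i , fi≡

module _ {m p} {P : Fin m → Set p} (P? : Decidable P) (f : Fin m → ℕ) where

  sucMaxOn : ℕ
  sucMaxOn = maximum (λ i → if does (P? i) then suc (f i) else 0)

  sucMaxOn-≥ : ∀ {i} → P i → suc (f i) ≤ sucMaxOn
  sucMaxOn-≥ {i} Pi =
    subst (_≤ sucMaxOn) (cong (λ c → if c then suc (f i) else 0) (dec-true (P? i) Pi))
          (≤-maximum _ i)

  sucMaxOn-attained : ∀ {k} → sucMaxOn ≡ suc k → ∃ λ i → P i × f i ≡ k
  sucMaxOn-attained max≡ with maximum-attained _ max≡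
  ... | i , fi≡ with P? i
  ...   | yes Pi = i , Pi , suc-injective fi≡
  ...   | no _ = contradiction fi≡ λ ()

  argmaxOn : ∃ P → ∃ λ i → P i × (∀ {j} → P j → f j ≤ f i)
  argmaxOn (j , Pj) with sucMaxOn in max≡ | sucMaxOn-≥ Pj
  ... | suc k | _ with sucMaxOn-attained max≡
  ...   | i , Pi , fi≡k =
    i , Pi , λ Pj′ → subst (_ ≤_) (sym fi≡k) (s≤s⁻¹ (subst (_ ≤_) max≡ (sucMaxOn-≥ Pj′)))

∧≡true : ∀ {p q} → p ∧ q ≡ true → p ≡ true × q ≡ true
∧≡true {true} {true} _ = refl , refl

∧-not≡true : ∀ {p q} → p ∧ not q ≡ true → p ≡ true × ¬ q ≡ true
∧-not≡true {true} {false} _ = refl , λ ()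

≢-cases : ∀ {p q} → p ≢ q → (p ≡ true × ¬ q ≡ true) ⊎ (¬ p ≡ true × q ≡ true)
≢-cases {true} {true} p≢q = contradiction refl p≢q
≢-cases {true} {false} _ = inj₁ (refl , λ ())
≢-cases {false} {true} _ = inj₂ ((λ ()) , refl)
≢-cases {false} {false} p≢q = contradiction refl p≢q

module _ (R : BRel n) where

  asym-intro : R ∋ x ⟨ y ⟩ → ¬ R ∋ y ⟨ x ⟩ → asym R ∋ x ⟨ y ⟩
  asym-intro Rxy ¬Ryx rewrite Rxy | ¬-not ¬Ryx = refl

  asym⇒R : asym R ∋ x ⟨ y ⟩ → R ∋ x ⟨ y ⟩
  asym⇒R = proj₁ ∘ ∧-not≡true

  asym⇒¬R : asym R ∋ x ⟨ y ⟩ → ¬ R ∋ y ⟨ x ⟩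
  asym⇒¬R = proj₂ ∘ ∧-not≡true

  asym-irrefl : asym R ∋ x ⟨ y ⟩ → x ≢ y
  asym-irrefl xy refl = asym⇒¬R xy (asym⇒R xy)

  ¬asym-flip : ¬ asym R ∋ x ⟨ y ⟩ → R ∋ x ⟨ y ⟩ → R ∋ y ⟨ x ⟩
  ¬asym-flip {x} {y} ¬xy Rxy = decidable-stable (R y x Bool.≟ true) (¬xy ∘ asym-intro Rxy)

≐-sym : R ≐ S → S ≐ R
≐-sym R≐S x y = sym (R≐S x y)

symm-transfer : ∀ (R S : BRel n) → symm R ≐ symm S → R ∋ x ⟨ y ⟩ → R ∋ y ⟨ x ⟩ → S ∋ y ⟨ x ⟩
symm-transfer {x = x} {y} R S R∼S Rxy Ryx =
  proj₂ (∧≡true (trans (sym (R∼S x y)) (cong₂ _∧_ Rxy Ryx)))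

module _ (R S : BRel n) (R∼S : symm R ≐ symm S) where

  ¬S⇒asym : R ∋ x ⟨ y ⟩ → ¬ S ∋ x ⟨ y ⟩ → asym R ∋ x ⟨ y ⟩
  ¬S⇒asym Rxy ¬Sxy = asym-intro R Rxy (λ Ryx → ¬Sxy (symm-transfer R S R∼S Ryx Rxy))

  ¬asym⇒¬S : asym R ∋ x ⟨ y ⟩ → ¬ asym S ∋ x ⟨ y ⟩ → ¬ S ∋ x ⟨ y ⟩
  ¬asym⇒¬S x≻y ¬x▷y Sxy =
    asym⇒¬R R x≻y (symm-transfer S R (≐-sym R∼S) Sxy (¬asym-flip S ¬x▷y Sxy))

≐-dec : (R S : BRel n) → Dec (R ≐ S)
≐-dec R S = all? λ x → all? λ y → R x y Bool.≟ S x y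

¬≐⇒differ : (R S : BRel n) → ¬ R ≐ S → ∃₂ λ a b → R a b ≢ S a b
¬≐⇒differ {n} R S R≠S with ¬∀⟶∃¬ n _ (λ x → all? λ y → R x y Bool.≟ S x y) R≠S
... | a , ¬row = a , ¬∀⟶∃¬ n _ (λ y → R a y Bool.≟ S a y) ¬row

record AgreeExcept (R S : BRel n) (a b : Fin n) : Set where
  field agree : ∀ x y → ¬ (x ≡ a × y ≡ b) → S x y ≡ R x y

addPair-agrees : (R : BRel n) (a b : Fin n) → AgreeExcept R (addPair R a b) a b
addPair-agrees R a b .AgreeExcept.agree x y ¬ab with x ≟ a | y ≟ b
... | yes x≡a | yes y≡b = contradiction (x≡a , y≡b) ¬ab
... | yes _ | no _ = ∨-identityʳ _
... | no _ | _ = ∨-identityʳ _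

addPair-at : ∀ (R : BRel n) a b → addPair R a b ∋ a ⟨ b ⟩
addPair-at R a b with a ≟ a | b ≟ b
... | yes _ | yes _ = ∨-zeroʳ _
... | no a≢a | _ = contradiction refl a≢a
... | yes _ | no b≢b = contradiction refl b≢b

removePair-agrees : (R : BRel n) (a b : Fin n) → AgreeExcept R (removePair R a b) a b
removePair-agrees R a b .AgreeExcept.agree x y ¬ab with x ≟ a | y ≟ b
... | yes x≡a | yes y≡b = contradiction (x≡a , y≡b) ¬ab
... | yes _ | no _ = ∧-identityʳ _
... | no _ | _ = ∧-identityʳ _

removePair-at : ∀ (R : BRel n) a b → removePair R a b a b ≡ false
removePair-at R a b with a ≟ a | b ≟ b
... | yes _ | yes _ = ∧-zeroʳ _
... | no a≢a | _ = contradiction refl a≢a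
... | yes _ | no b≢b = contradiction refl b≢b

module _ (agreement : AgreeExcept R S a b) (a≢b : a ≢ b) where
  open AgreeExcept agreement

  agree-flipped : S b a ≡ R b a
  agree-flipped = agree b a λ (b≡a , _) → a≢b (sym b≡a)

  agree-refl : Reflexive R → Reflexive S
  agree-refl reflR x = trans (agree x x λ (x≡a , x≡b) → a≢b (trans (sym x≡a) x≡b)) (reflR x)

  agree-symm : R b a ≡ false → symm S ≐ symm R
  agree-symm Rba≡false x y with x ≟ a ×-dec y ≟ b | y ≟ a ×-dec x ≟ b
  ... | yes (refl , refl) | _ =
    trans (cong (S x y ∧_) (trans agree-flipped Rba≡false))
          (trans (∧-zeroʳ _) (sym (trans (cong (R x y ∧_) Rba≡false) (∧-zeroʳ _))))
  ... | no _ | yes (refl , refl) =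
    trans (cong (_∧ S y x) (trans agree-flipped Rba≡false)) (sym (cong (_∧ R y x) Rba≡false))
  ... | no ¬xy | no ¬yx = cong₂ _∧_ (agree x y ¬xy) (agree y x ¬yx)

mismatch : Bool → Bool → ℕ
mismatch true true = 0
mismatch true false = 1
mismatch false true = 1
mismatch false false = 0

mismatch-self : ∀ p → mismatch p p ≡ 0
mismatch-self true = refl
mismatch-self false = refl

mismatch-≢ : ∀ {p q} → p ≢ q → 0 < mismatch p q
mismatch-≢ {true} {true} p≢q = contradiction refl p≢q
mismatch-≢ {true} {false} _ = s≤s z≤n
mismatch-≢ {false} {true} _ = s≤s z≤n
mismatch-≢ {false} {false} p≢q = contradiction refl p≢q

disagreements : BRel n → BRel n → ℕ
disagreements R T = ∑ λ x → ∑ λ y → mismatch (R x y) (T x y)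

agree-disagreements : AgreeExcept R S a b → S a b ≡ T a b → R a b ≢ T a b →
                      disagreements S T < disagreements R T
agree-disagreements {R = R} {S} {a} {b} {T} agreement fixed differed =
  ∑-mono-< (λ x → ∑-mono-≤ (pointwise x)) a (∑-mono-< (pointwise a) b at-ab)
  where
    at-ab : mismatch (S a b) (T a b) < mismatch (R a b) (T a b)
    at-ab = subst (_< _) (sym (trans (cong (λ s → mismatch s (T a b)) fixed) (mismatch-self _)))
                  (mismatch-≢ differed)

    pointwise : ∀ x y → mismatch (S x y) (T x y) ≤ mismatch (R x y) (T x y)
    pointwise x y with x ≟ a ×-dec y ≟ b
    ... | yes (refl , refl) = <⇒≤ at-ab
    ... | no ¬ab =
      ≤-reflexive (cong (λ s → mismatch s (T x y)) (AgreeExcept.agree agreement x y ¬ab))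

Walk : BRel n → ℕ → (ℕ → Fin n) → Set
Walk R L f = ∀ i → i < L → asym R ∋ f i ⟨ f (suc i) ⟩

ClosedWalk : BRel n → ℕ → (ℕ → Fin n) → Set
ClosedWalk R L f = Walk R (suc L) f × f (suc L) ≡ f 0

module _ (R : BRel n) where

  walk-segment : ∀ {L} f i {d} → Walk R L f → i + d ≤ L → Walk R d (λ t → f (i + t))
  walk-segment f i walk i+d≤L t t<d =
    subst (λ s → asym R ∋ f (i + t) ⟨ f s ⟩) (sym (+-suc i t))
          (walk (i + t) (<-≤-trans (+-monoʳ-< i t<d) i+d≤L))

  repeat⇒closedWalk : ∀ {L i j} f → Walk R L f → i < j → j ≤ L → f i ≡ f j →
                      ∃ λ d → d < j × ∃ (ClosedWalk R d)
  repeat⇒closedWalk {i = i} {j} f walk i<j j≤L fi≡fj with m≤n⇒∃[o]m+o≡n i<j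
  ... | d , 1+i+d≡j =
    d , <-≤-trans (m≤n+m (suc d) i) (≤-reflexive i+1+d≡j) ,
    (λ t → f (i + t)) ,
    walk-segment f i walk (≤-trans (≤-reflexive i+1+d≡j) j≤L) ,
    trans (cong f i+1+d≡j) (trans (sym fi≡fj) (cong f (sym (+-identityʳ i))))
    where
      i+1+d≡j : i + suc d ≡ j
      i+1+d≡j = trans (+-suc i d) 1+i+d≡j

  Acyclic⇒no-closedWalk : Acyclic R → ∀ {L} f → ClosedWalk R L f → ⊥
  Acyclic⇒no-closedWalk acR = shorten (<-wellFounded _)
    where
      -- A closed walk without repeated vertices is a cycle; one with a repetition
      -- contains a shorter closed walk.
      shorten : ∀ {L} → Acc _<_ L → ∀ f → ClosedWalk R L f → ⊥
      shorten {L} (acc shorter) f (walk , closed)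
        with any? (λ i → any? (λ j → i <? j ×-dec f (toℕ i) ≟ f (toℕ j)))
      ... | yes (i , j , i<j , fi≡fj) with repeat⇒closedWalk f walk i<j (<⇒≤ (toℕ<n j)) fi≡fj
      ...   | d , d<j , g , closedWalk =
        shorten (shorter (<-≤-trans d<j (s≤s⁻¹ (toℕ<n j)))) g closedWalk
      shorten {L} _ f (walk , closed) | no no-repeat = acR L (f ∘ toℕ) injective (edges , last)
        where
          injective : ∀ {i j} → f (toℕ i) ≡ f (toℕ j) → i ≡ j
          injective {i} {j} fi≡fj with <-cmp i j
          ... | tri< i<j _ _ = contradiction (i , j , i<j , fi≡fj) no-repeat
          ... | tri≈ _ i≡j _ = i≡j
          ... | tri> _ _ j<i = contradiction (j , i , j<i , sym fi≡fj) no-repeat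

          edges : ∀ (i : Fin L) → asym R ∋ f (toℕ (inject₁ i)) ⟨ f (toℕ (suc i)) ⟩
          edges i = subst (λ s → asym R ∋ f s ⟨ f (suc (toℕ i)) ⟩) (sym (toℕ-inject₁ i))
                          (walk (toℕ i) (≤-trans (toℕ<n i) (n≤1+n L)))

          last : asym R ∋ f (toℕ (fromℕ L)) ⟨ f 0 ⟩
          last = subst₂ (λ s t → asym R ∋ f s ⟨ t ⟩) (sym (toℕ-fromℕ L)) closed (walk L ≤-refl)

  Acyclic⇒no-long-walk : Acyclic R → ∀ {L} f → n ≤ L → Walk R L f → ⊥
  Acyclic⇒no-long-walk acR f n≤L walk
    with pigeonhole (n<1+n _) (λ (t : Fin (suc _)) → f (toℕ t))
  ... | i , j , i<j , fi≡fj
    with repeat⇒closedWalk f walk i<j (≤-trans (s≤s⁻¹ (toℕ<n j)) n≤L) fi≡fj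
  ...   | _ , _ , g , closedWalk = Acyclic⇒no-closedWalk acR g closedWalk

module Height (T : BRel n) where

  -- longest k v is the length of a longest ▷-walk from v with at most k steps.
  longest : ℕ → Fin n → ℕ
  longest zero _ = 0
  longest (suc k) v = sucMaxOn (λ w → asym T v w Bool.≟ true) (longest k)

  longest-edge : ∀ k → asym T ∋ u ⟨ v ⟩ → suc (longest k v) ≤ longest (suc k) u
  longest-edge {u} k = sucMaxOn-≥ (λ w → asym T u w Bool.≟ true) (longest k)

  longest-walk : ∀ {m} k v → longest k v ≡ m → ∃ λ f → f 0 ≡ v × Walk T m f
  longest-walk {zero} _ v _ = (λ _ → v) , refl , λ _ ()
  longest-walk {suc m} (suc k) v longest≡
    with sucMaxOn-attained (λ w → asym T v w Bool.≟ true) (longest k) longest≡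
  ... | w , v▷w , longest≡′ with longest-walk k w longest≡′
  ...   | g , g0≡w , walk = (λ { zero → v ; (suc i) → g i }) , refl , λ where
          zero _ → subst (λ s → asym T ∋ v ⟨ s ⟩) (sym g0≡w) v▷w
          (suc i) i<m → walk i (s≤s⁻¹ i<m)

  longest-saturated : ∀ k v → longest k v < longest (suc k) v → longest (suc k) v ≡ suc k
  longest-saturated k v grows with longest (suc k) v in longest≡
  longest-saturated k v () | zero
  ... | suc m with sucMaxOn-attained (λ w → asym T v w Bool.≟ true) (longest k) longest≡
  longest-saturated zero v _ | suc m | _ , _ , longest≡′ = cong suc (sym longest≡′)
  longest-saturated (suc k) v grows | suc m | w , v▷w , longest≡′ =
    cong suc (trans (sym longest≡′) (longest-saturated k w w-grows))
    where
      w-grows : longest k w < longest (suc k) w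
      w-grows = subst (longest k w <_) (sym longest≡′)
                      (s≤s⁻¹ (≤-<-trans (longest-edge k v▷w) grows))

  height : Fin n → ℕ
  height = longest n

  height-decreasing : Acyclic T → asym T ∋ u ⟨ v ⟩ → height v < height u
  height-decreasing {u = u} acT u▷v with longest (suc n) u ≤? longest n u
  ... | yes stable = ≤-trans (longest-edge n u▷v) stable
  ... | no grows with longest-walk (suc n) u (longest-saturated n u (≰⇒> grows))
  ...   | f , _ , walk = ⊥-elim (Acyclic⇒no-long-walk T acT f (n≤1+n n) walk)

Acyclic-⊆ : ∀ (R S : BRel n) → (∀ {u v} → asym S ∋ u ⟨ v ⟩ → asym R ∋ u ⟨ v ⟩) →
            Acyclic R → Acyclic S
Acyclic-⊆ R S S⊆R acR k z injective (edges , last) =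
  acR k z injective ((λ i → S⊆R (edges i)) , S⊆R last)

asym-removePair : ∀ (R : BRel n) a b → ¬ R ∋ b ⟨ a ⟩ →
                  asym (removePair R a b) ∋ u ⟨ v ⟩ → asym R ∋ u ⟨ v ⟩
asym-removePair {u = u} {v} R a b ¬Rba uv = asym-intro R Ruv ¬Rvu
  where
    Ruv : R ∋ u ⟨ v ⟩
    Ruv = proj₁ (∧≡true (asym⇒R (removePair R a b) uv))

    ¬Rvu : ¬ R ∋ v ⟨ u ⟩
    ¬Rvu with v ≟ a ×-dec u ≟ b
    ... | yes (refl , refl) = λ _ → ¬Rba Ruv
    ... | no ¬ab =
      asym⇒¬R (removePair R a b) uv ∘ trans (AgreeExcept.agree (removePair-agrees R a b) v u ¬ab)

asym-addPair : ∀ (R : BRel n) a b → asym (addPair R a b) ∋ u ⟨ v ⟩ →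
               (u ≡ a × v ≡ b) ⊎ asym R ∋ u ⟨ v ⟩
asym-addPair {u = u} {v} R a b uv with u ≟ a ×-dec v ≟ b
... | yes ab = inj₁ ab
... | no ¬ab = inj₂ (asym-intro R Ruv (λ Rvu → asym⇒¬R (addPair R a b) uv (cong (_∨ _) Rvu)))
  where
    Ruv : R ∋ u ⟨ v ⟩
    Ruv = trans (sym (AgreeExcept.agree (addPair-agrees R a b) u v ¬ab)) (asym⇒R (addPair R a b) uv)

module _ (E : Fin n → Fin n → Set) {P : Fin n → Set} (closed : ∀ {u v} → E u v → P u → P v) where

  cycle-closed : ∀ {k} (z : Fin (suc k) → Fin n) →
                 (∀ i → E (z (inject₁ i)) (z (suc i))) → E (z (fromℕ k)) (z zero) →
                 ∀ j → P (z j) → ∀ i → P (z i)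
  cycle-closed z edges last j Pj = forward z edges (closed last (to-last z edges j Pj))
    where
      forward : ∀ {k} (z : Fin (suc k) → Fin n) → (∀ i → E (z (inject₁ i)) (z (suc i))) →
                P (z zero) → ∀ i → P (z i)
      forward z edges P0 zero = P0
      forward {suc k} z edges P0 (suc i) =
        closed (edges i) (forward (z ∘ inject₁) (edges ∘ inject₁) P0 i)

      to-last : ∀ {k} (z : Fin (suc k) → Fin n) → (∀ i → E (z (inject₁ i)) (z (suc i))) →
                ∀ j → P (z j) → P (z (fromℕ k))
      to-last {zero} z edges zero Pj = Pj
      to-last {suc k} z edges zero Pj =
        to-last (z ∘ suc) (edges ∘ suc) zero (closed (edges zero) Pj)
      to-last {suc k} z edges (suc j) Pj = to-last (z ∘ suc) (edges ∘ suc) j Pj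

Acyclic-addPair : ∀ (R : BRel n) a b → Acyclic R → (G : Fin n → Set) → G b → ¬ G a →
                  (∀ {u v} → asym (addPair R a b) ∋ u ⟨ v ⟩ → G u → G v) →
                  Acyclic (addPair R a b)
Acyclic-addPair R a b acR G Gb ¬Ga G-closed k z injective (edges , last)
  with any? (λ j → z j ≟ b)
... | yes (j , zj≡b) =
  acR k z injective ( (λ i → old-from-G (edges i) (inG (inject₁ i)))
                    , old-from-G last (inG (fromℕ k)) )
  where
    inG : ∀ i → G (z i)
    inG = cycle-closed (λ u v → asym (addPair R a b) ∋ u ⟨ v ⟩) G-closed
                       z edges last j (subst G (sym zj≡b) Gb)

    old-from-G : asym (addPair R a b) ∋ u ⟨ v ⟩ → G u → asym R ∋ u ⟨ v ⟩
    old-from-G uv Gu with asym-addPair R a b uv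
    ... | inj₁ (refl , _) = contradiction Gu ¬Ga
    ... | inj₂ old = old
... | no b∉z =
  acR k z injective ( (λ i → old-to-¬b (edges i) (b∉z ∘ (suc i ,_)))
                    , old-to-¬b last (b∉z ∘ (zero ,_)) )
  where
    old-to-¬b : asym (addPair R a b) ∋ u ⟨ v ⟩ → v ≢ b → asym R ∋ u ⟨ v ⟩
    old-to-¬b uv v≢b with asym-addPair R a b uv
    ... | inj₁ (_ , v≡b) = contradiction v≡b v≢b
    ... | inj₂ old = old

module Perturbation (T : BRel n) (h : Fin n → ℕ)
                    (h-decreasing : ∀ {u v} → asym T ∋ u ⟨ v ⟩ → h v < h u) where

  Improvement : BRel n → Set
  Improvement R = Σ[ R₀ ∈ BRel n ] ( OneStep R R₀ T × AcyclicOrder R₀ × symm R₀ ≐ symm T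
                                   × disagreements R₀ T < disagreements R T )

  module _ {R : BRel n} (reflR : Reflexive R) (acR : Acyclic R) (R∼T : symm R ≐ symm T) where

    Excess : Fin n → Fin n → Set
    Excess a b = asym R ∋ a ⟨ b ⟩ × ¬ asym T ∋ a ⟨ b ⟩

    Excess? : ∀ a b → Dec (Excess a b)
    Excess? a b = (asym R a b Bool.≟ true) ×-dec ¬? (asym T a b Bool.≟ true)

    reversed-Excess : asym T ∋ x ⟨ b ⟩ → ¬ R ∋ x ⟨ b ⟩ → R ∋ b ⟨ x ⟩ → Excess b x
    reversed-Excess x▷b ¬Rxb Rbx = asym-intro R Rbx ¬Rxb , asym⇒¬R T x▷b ∘ asym⇒R T

    improve-by-removal : Excess a b → (∀ x → asym T ∋ x ⟨ b ⟩ → asym R ∋ x ⟨ b ⟩) → Improvement R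
    improve-by-removal {a} {b} (a≻b , ¬a▷b) preds =
      removePair R a b ,
      inj₁ (a , b , a≻b , (λ _ _ → refl) , ¬a▷b , preds) ,
      (agree-refl agreement a≢b reflR ,
       Acyclic-⊆ R (removePair R a b) (asym-removePair R a b (asym⇒¬R R a≻b)) acR) ,
      (λ x y → trans (agree-symm agreement a≢b (¬-not (asym⇒¬R R a≻b)) x y) (R∼T x y)) ,
      agree-disagreements agreement (trans (removePair-at R a b) (sym (¬-not ¬Tab)))
                          (λ Rab≡Tab → ¬Tab (trans (sym Rab≡Tab) (asym⇒R R a≻b)))
      where
        agreement : AgreeExcept R (removePair R a b) a b
        agreement = removePair-agrees R a b

        a≢b : a ≢ b
        a≢b = asym-irrefl R a≻b

        ¬Tab : ¬ T ∋ a ⟨ b ⟩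
        ¬Tab = ¬asym⇒¬S R T R∼T a≻b ¬a▷b

    improve-by-addition : asym T ∋ x ⟨ b ⟩ → ¬ R ∋ x ⟨ b ⟩ → ¬ R ∋ b ⟨ x ⟩ →
                          (∀ {c d} → Excess c d → h d ≤ h b) → Improvement R
    improve-by-addition {x} {b} x▷b ¬Rxb ¬Rbx excess-below =
      addPair R x b ,
      inj₂ (x , b , x≢b , ¬x≻b , ¬b≻x ,
            (x≢b , ¬x≻b , ¬b≻x , inj₁ ((¬Rxb , ¬Rbx) , λ _ _ → refl) , acyclic) , x▷b) ,
      (agree-refl agreement x≢b reflR , acyclic) ,
      (λ u v → trans (agree-symm agreement x≢b (¬-not ¬Rbx) u v) (R∼T u v)) ,
      agree-disagreements agreement (trans (addPair-at R x b) (sym (asym⇒R T x▷b)))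
                          (λ Rxb≡Txb → ¬Rxb (trans Rxb≡Txb (asym⇒R T x▷b)))
      where
        agreement : AgreeExcept R (addPair R x b) x b
        agreement = addPair-agrees R x b

        x≢b : x ≢ b
        x≢b = asym-irrefl T x▷b

        ¬x≻b : ¬ asym R ∋ x ⟨ b ⟩
        ¬x≻b = ¬Rxb ∘ asym⇒R R

        ¬b≻x : ¬ asym R ∋ b ⟨ x ⟩
        ¬b≻x = ¬Rbx ∘ asym⇒R R

        below-b : Fin n → Set
        below-b v = h v ≤ h b

        below-b-closed : asym (addPair R x b) ∋ u ⟨ v ⟩ → below-b u → below-b v
        below-b-closed {u} {v} uv u-below with asym-addPair R x b uv
        ... | inj₁ (_ , refl) = ≤-refl
        ... | inj₂ u≻v with asym T u v Bool.≟ true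
        ...   | yes u▷v = <⇒≤ (<-≤-trans (h-decreasing u▷v) u-below)
        ...   | no ¬u▷v = excess-below (u≻v , ¬u▷v)

        acyclic : Acyclic (addPair R x b)
        acyclic = Acyclic-addPair R x b acR below-b ≤-refl (<⇒≱ (h-decreasing x▷b)) below-b-closed

    ▷⇒≻? : ∀ b x → Dec (asym T ∋ x ⟨ b ⟩ → asym R ∋ x ⟨ b ⟩)
    ▷⇒≻? b x = (asym T x b Bool.≟ true) →-dec (asym R x b Bool.≟ true)

    improve : ¬ R ≐ T → Improvement R
    improve R≠T with any? (λ b → any? λ a → Excess? a b)
    ... | yes some-excess with argmaxOn (λ b → any? λ a → Excess? a b) h some-excess
    ...   | b , (a , excess) , highest with all? (▷⇒≻? b)
    ...     | yes preds = improve-by-removal excess preds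
    ...     | no ¬preds with ¬∀⟶∃¬ n _ (▷⇒≻? b) ¬preds
    ...       | w , ¬pred = improve-by-addition w▷b ¬Rwb ¬Rbw (λ e → highest (_ , e))
      where
        w▷b : asym T ∋ w ⟨ b ⟩
        w▷b = decidable-stable (asym T w b Bool.≟ true)
                               λ ¬w▷b → ¬pred λ w▷b → contradiction w▷b ¬w▷b

        ¬Rwb : ¬ R ∋ w ⟨ b ⟩
        ¬Rwb = ¬asym⇒¬S T R (≐-sym R∼T) w▷b (¬pred ∘ const)

        ¬Rbw : ¬ R ∋ b ⟨ w ⟩
        ¬Rbw Rbw = <⇒≱ (h-decreasing w▷b) (highest (b , reversed-Excess w▷b ¬Rwb Rbw))
    improve R≠T | no no-excess with ¬≐⇒differ R T R≠T
    ... | a , b , Rab≢Tab with ≢-cases Rab≢Tab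
    ...   | inj₁ (Rab , ¬Tab) =
      contradiction (b , a , ¬S⇒asym R T R∼T Rab ¬Tab , ¬Tab ∘ asym⇒R T) no-excess
    ...   | inj₂ (¬Rab , Tab) =
      improve-by-addition a▷b ¬Rab ¬Rba λ {c} {d} e → contradiction (d , c , e) no-excess
      where
        a▷b : asym T ∋ a ⟨ b ⟩
        a▷b = ¬S⇒asym T R (≐-sym R∼T) Tab ¬Rab

        ¬Rba : ¬ R ∋ b ⟨ a ⟩
        ¬Rba Rba = no-excess (a , b , reversed-Excess a▷b ¬Rab Rba)

PerturbationChain : BRel n → BRel n → Set
PerturbationChain {n} R T =
  ∃[ p ] Σ[ S ∈ (Fin (suc p) → BRel n) ] ( (∀ (k : Fin (suc p)) → AcyclicOrder (S k))
    × OneStep R (S zero) T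
    × (∀ (k : Fin p) → OneStep (S (inject₁ k)) (S (suc k)) T)
    × S (fromℕ p) ≐ T )

chain-single : AcyclicOrder S → OneStep R S T → S ≐ T → PerturbationChain R T
chain-single {S = S} ao step S≐T = 0 , (λ _ → S) , (λ _ → ao) , step , (λ ()) , S≐T

chain-cons : AcyclicOrder S → OneStep R S T → PerturbationChain S T → PerturbationChain R T
chain-cons {S = S} ao step (p , Ss , aos , first , next , last) =
  suc p , S ∷ Ss , (λ { zero → ao ; (suc k) → aos k }) , step ,
  (λ { zero → first ; (suc k) → next k }) , last

perturbation-chain : (T : BRel n) → Acyclic T → ∀ R → Acc _<_ (disagreements R T) →
                     AcyclicOrder R → symm R ≐ symm T → ¬ R ≐ T → PerturbationChain R T
perturbation-chain T acT R (acc fewer) (reflR , acR) R∼T R≠T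
  with Perturbation.improve T (Height.height T) (Height.height-decreasing T acT) reflR acR R∼T R≠T
... | R₀ , step , ao₀ , R₀∼T , closer with ≐-dec R₀ T
...   | yes R₀≐T = chain-single ao₀ step R₀≐T
...   | no R₀≠T = chain-cons ao₀ step (perturbation-chain T acT R₀ (fewer closer) ao₀ R₀∼T R₀≠T)

theorem2p2 : ∀ (n : ℕ) → 2 ≤ n → (R T : BRel n) →
    AcyclicOrder R → AcyclicOrder T →
    symm R ≐ symm T → ¬ (R ≐ T) →
    ∃[ p ] Σ[ S ∈ (Fin (suc p) → BRel n) ] ( (∀ (k : Fin (suc p)) → AcyclicOrder (S k))
    × OneStep R (S zero) T
    × (∀ (k : Fin p) → OneStep (S (inject₁ k)) (S (suc k)) T)
    × S (fromℕ p) ≐ T )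
theorem2p2 n _ R T aoR (_ , acT) R∼T R≠T =
  perturbation-chain T acT R (<-wellFounded _) aoR R∼T R≠T
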